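{- Let $\Gamma$ and $\Sigma$ be regular graphs with coprime valencies, and suppose that both $\Gamma$ and $\Sigma$ are $R$-thin and that $\Sigma$ is vertex-transitive. Then for any $(u,i)\in V(\Gamma\times\Sigma)$ and any $\sigma\in\mathrm{Aut}(\Gamma\times\Sigma)$, we have $(Y(u,i))^\sigma=Y((u,i)^\sigma)$.
   Context: Graphs are finite and simple, $\Sigma$ has at least two vertices; $\mathrm{val}(\cdot)$ is the valency of a regular graph and $N_\Delta(x)$ the neighbourhood of $x$ in $\Delta$. The direct product $\Gamma\times\Sigma$ has vertex set $V(\Gamma)\times V(\Sigma)$, with $(u,x)\sim(v,y)$ iff $u\sim v$ in $\Gamma$ and $x\sim y$ in $\Sigma$. A graph is $R$-thin if distinct vertices have distinct neighbourhoods. For $(u,i),(v,j)\in V(\Gamma\times\Sigma)$ let $f((u,i),(v,j))=|N_{\Gamma\times\Sigma}((u,i))\cap N_{\Gamma\times\Sigma}((v,j))|/|N_{\Gamma\times\Sigma}((u,i))|$; let $X(u,i)=\{(v,j)\ne(u,i): \mathrm{val}(\Sigma)\cdot f((u,i),(v,j))\text{ is a positive integer}\}$; and let $Y(u,i)=\{(v,j)\in X(u,i): f((u,i),(v,j))\geq f((u,i),(w,j))\text{ for all }w\in V(\Gamma)\}$. -}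

module Defs where

open import Data.Nat using (ℕ; zero; suc; _+_; _*_; _≤_; _≥_)
open import Data.Bool using (Bool; true; false; _∧_; if_then_else_)
open import Data.Fin using (Fin; zero; suc; combine; remQuot)
open import Data.Fin.Permutation using (Permutation′; _⟨$⟩ʳ_)
open import Data.Product using (Σ; _×_; _,_; ∃; proj₁; proj₂)
open import Relation.Binary.PropositionalEquality using (_≡_; _≢_; refl; cong₂)

countF : ∀ {n} → (Fin n → Bool) → ℕ
countF {zero}  p = 0
countF {suc n} p = (if p zero then 1 else 0) + countF (λ i → p (suc i))

record Graph : Set where
  field
    n      : ℕ
    adj    : Fin n → Fin n → Bool
    sym    : ∀ x y → adj x y ≡ adj y x
    irrefl : ∀ x → adj x x ≡ false
open Graph public

deg : (G : Graph) → Fin (n G) → ℕ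
deg G x = countF (adj G x)

common : (G : Graph) → Fin (n G) → Fin (n G) → ℕ
common G x y = countF (λ z → adj G x z ∧ adj G y z)

Regular : Graph → ℕ → Set
Regular G k = ∀ x → deg G x ≡ k

RThin : Graph → Set
RThin G = ∀ x y → (∀ z → adj G x z ≡ adj G y z) → x ≡ y

IsAut : (G : Graph) → Permutation′ (n G) → Set
IsAut G σ = ∀ x y → adj G (σ ⟨$⟩ʳ x) (σ ⟨$⟩ʳ y) ≡ adj G x y

Aut : Graph → Set
Aut G = Σ (Permutation′ (n G)) (IsAut G)

VertexTransitive : Graph → Set
VertexTransitive G = ∀ x y → Σ (Aut G) λ σ → proj₁ σ ⟨$⟩ʳ x ≡ y

-- Direct product Γ × Σ; vertex (u , i) is encoded as combine u i
-- (coordinates recovered by remQuot).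
fstV : (Γ S : Graph) → Fin (n Γ * n S) → Fin (n Γ)
fstV Γ S a = proj₁ (remQuot {n Γ} (n S) a)

sndV : (Γ S : Graph) → Fin (n Γ * n S) → Fin (n S)
sndV Γ S a = proj₂ (remQuot {n Γ} (n S) a)

prodAdj : (Γ S : Graph) → Fin (n Γ * n S) → Fin (n Γ * n S) → Bool
prodAdj Γ S a b = adj Γ (fstV Γ S a) (fstV Γ S b) ∧ adj S (sndV Γ S a) (sndV Γ S b)

prodSym : (Γ S : Graph) → ∀ a b → prodAdj Γ S a b ≡ prodAdj Γ S b a
prodSym Γ S a b = cong₂ _∧_ (sym Γ _ _) (sym S _ _)

prodIrr : (Γ S : Graph) → ∀ a → prodAdj Γ S a a ≡ false
prodIrr Γ S a rewrite irrefl Γ (fstV Γ S a) = refl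

_⊗_ : Graph → Graph → Graph
Γ ⊗ S = record
  { n = n Γ * n S ; adj = prodAdj Γ S ; sym = prodSym Γ S ; irrefl = prodIrr Γ S }

vx : (Γ S : Graph) → Fin (n Γ) → Fin (n S) → Fin (n (Γ ⊗ S))
vx Γ S u i = combine u i

-- val(Σ)·f(a,b) is a positive integer, where
-- f(a,b) = common(a,b)/deg(a):  ∃ k ≥ 1 with valΣ · common(a,b) = k · deg(a).
IntRatio : (P : Graph) → ℕ → Fin (n P) → Fin (n P) → Set
IntRatio P valS a b = ∃ λ k → 1 ≤ k × valS * common P a b ≡ k * deg P a

InX : (Γ S : Graph) → ℕ → Fin (n Γ) → Fin (n S) → Fin (n Γ) → Fin (n S) → Set
InX Γ S valS u i v j =
  vx Γ S v j ≢ vx Γ S u i × IntRatio (Γ ⊗ S) valS (vx Γ S u i) (vx Γ S v j)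

-- f(a,b) ≥ f(a,c), both fractions having denominator deg(a):
-- common(a,b)/deg(a) ≥ common(a,c)/deg(a), cross-multiplied.
fGeq : (P : Graph) → Fin (n P) → Fin (n P) → Fin (n P) → Set
fGeq P a b c = common P a c * deg P a ≤ common P a b * deg P a

InY : (Γ S : Graph) → ℕ → Fin (n Γ) → Fin (n S) → Fin (n Γ) → Fin (n S) → Set
InY Γ S valS u i v j =
  InX Γ S valS u i v j ×
  (∀ w → fGeq (Γ ⊗ S) (vx Γ S u i) (vx Γ S v j) (vx Γ S w j))

InY' : (Γ S : Graph) → ℕ → Fin (n (Γ ⊗ S)) → Fin (n (Γ ⊗ S)) → Set
InY' Γ S valS a b =
  InY Γ S valS (fstV Γ S a) (sndV Γ S a) (fstV Γ S b) (sndV Γ S b)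

-- Write k = val Γ and l = val Σ. Membership in Y(a) can be described using only the graph
-- Γ × Σ and the numbers k, l: b ∈ Y(a) iff b ∈ X(a) and k divides |N(a) ∩ N(c)| for every c
-- with N(a) ∩ N(b) ⊆ N(c). This description is visibly invariant under automorphisms.
-- To prove it, let a = (u,i) have a neighbour (otherwise all counts vanish) and b = (v,j) ∈ X(a),
-- so that both factors of |N(a) ∩ N(b)| = |N_Γ(u) ∩ N_Γ(v)| · |N_Σ(i) ∩ N_Σ(j)| are positive. Each of the two
-- conditions forces u = v by R-thinness of Γ: maximality of f at w = u gives
-- |N_Γ(u) ∩ N_Γ(v)| ≥ k, while the divisibility condition at c = (v,i) gives
-- k ∣ l · |N_Γ(u) ∩ N_Γ(v)|, hence k ≤ |N_Γ(u) ∩ N_Γ(v)| by coprimality. Conversely, for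
-- b = (u,j) the common neighbours (y,t) of a and b have y ranging over all of N_Γ(u), so every
-- such c = (w,m) has N_Γ(u) ⊆ N_Γ(w) and |N(a) ∩ N(c)| = k · |N_Σ(i) ∩ N_Σ(m)|.
{-# OPTIONS --safe #-}
module Submission where

open import Defs hiding (sym)
open import Algebra.Bundles using (CommutativeMonoid)
import Algebra.Properties.CommutativeMonoid.Sum as MonoidSum
import Algebra.Properties.CommutativeSemigroup as CommutativeSemigroupProperties
open import Data.Bool using (Bool; true; false; _∧_; if_then_else_)
open import Data.Bool.Properties using (∧-idem; ∧-conicalˡ; ∧-conicalʳ; ⇔→≡; ∧-commutativeMonoid)
open import Data.Fin using (Fin; zero; suc; _↑ˡ_; _↑ʳ_; remQuot; quotient; remainder)
open import Data.Fin.Properties using (remQuot-combine; combine-remQuot; splitAt-↑ʳ)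
open import Data.Fin.Permutation using (Permutation′; _⟨$⟩ʳ_; _⟨$⟩ˡ_; inverseˡ; inverseʳ; flip)
open import Data.Nat using (ℕ; zero; suc; _+_; _*_; _≤_; _<_; z≤n; s≤s; NonZero; >-nonZero; ≢-nonZero)
open import Data.Nat.Coprimality using (Coprime; coprime-divisor)
open import Data.Nat.Divisibility using (_∣_; _∣0; m∣m*n; ∣⇒≤)
open import Data.Nat.Properties
open import Data.Product using (_×_; _,_; ∃; proj₁; proj₂)
open import Function using (_∘_; _⇔_; mk⇔; Equivalence)
open import Relation.Nullary using (yes; no; contradiction)
open import Relation.Binary.PropositionalEquality

open ≡-Reasoning

_⊆ᵇ_ : ∀ {m} → (Fin m → Bool) → (Fin m → Bool) → Set
p ⊆ᵇ q = ∀ x → p x ≡ true → q x ≡ true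

indicator-mono : ∀ {a b : Bool} → (a ≡ true → b ≡ true) →
  (if a then 1 else 0) ≤ (if b then 1 else 0)
indicator-mono {false} _   = z≤n
indicator-mono {true}  a⇒b rewrite a⇒b refl = ≤-refl

countF-cong : ∀ {m} {p q : Fin m → Bool} → p ≗ q → countF p ≡ countF q
countF-cong {zero}  eq = refl
countF-cong {suc m} eq =
  cong₂ _+_ (cong (λ b → if b then 1 else 0) (eq zero)) (countF-cong (eq ∘ suc))

countF-mono : ∀ {m} {p q : Fin m → Bool} → p ⊆ᵇ q → countF p ≤ countF q
countF-mono {zero}  p⊆q = z≤n
countF-mono {suc m} p⊆q = +-mono-≤ (indicator-mono (p⊆q zero)) (countF-mono (p⊆q ∘ suc))

countF-mono-< : ∀ {m} {p q : Fin m → Bool} → p ⊆ᵇ q →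
  ∀ x → p x ≡ false → q x ≡ true → countF p < countF q
countF-mono-< {suc m} {p} {q} p⊆q zero px qx rewrite px | qx = s≤s (countF-mono (p⊆q ∘ suc))
countF-mono-< {suc m} p⊆q (suc x) px qx =
  +-mono-≤-< (indicator-mono (p⊆q zero)) (countF-mono-< (p⊆q ∘ suc) x px qx)

⊆ᵇ-countF-≤⇒⊇ : ∀ {m} {p q : Fin m → Bool} → p ⊆ᵇ q → countF q ≤ countF p → q ⊆ᵇ p
⊆ᵇ-countF-≤⇒⊇ {p = p} p⊆q q≤p x qx with p x in px
... | true  = refl
... | false = contradiction (countF-mono-< p⊆q x px qx) (≤⇒≯ q≤p)

countF-nonZero⇒∃ : ∀ {m} (p : Fin m → Bool) → .{{NonZero (countF p)}} → ∃ λ x → p x ≡ true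
countF-nonZero⇒∃ {suc m} p with p zero in p₀
... | true  = zero , p₀
... | false = let x , px = countF-nonZero⇒∃ (p ∘ suc) in suc x , px

countF-false : ∀ {m} → countF {m} (λ _ → false) ≡ 0
countF-false {zero}  = refl
countF-false {suc m} = countF-false {m}

countF-∧ˡ : ∀ {m} b (q : Fin m → Bool) → countF (λ x → b ∧ q x) ≡ (if b then 1 else 0) * countF q
countF-∧ˡ {m} true  q = sym (+-identityʳ (countF q))
countF-∧ˡ {m} false q = countF-false {m}

module ℕSum = MonoidSum +-0-commutativeMonoid

countF≡sum : ∀ {m} (p : Fin m → Bool) → countF p ≡ ℕSum.sum (λ x → if p x then 1 else 0)
countF≡sum {zero}  p = refl
countF≡sum {suc m} p = cong ((if p zero then 1 else 0) +_) (countF≡sum (p ∘ suc))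

countF-permute : ∀ {m} (p : Fin m → Bool) (π : Permutation′ m) → countF (p ∘ (π ⟨$⟩ʳ_)) ≡ countF p
countF-permute p π = begin
  countF (p ∘ (π ⟨$⟩ʳ_))                            ≡⟨ countF≡sum (p ∘ (π ⟨$⟩ʳ_)) ⟩
  ℕSum.sum (λ x → if p (π ⟨$⟩ʳ x) then 1 else 0)   ≡⟨ ℕSum.sum-permute (λ x → if p x then 1 else 0) π ⟨
  ℕSum.sum (λ x → if p x then 1 else 0)            ≡⟨ countF≡sum p ⟨
  countF p                                         ∎

countF-↑ : ∀ m {r} (p : Fin (m + r) → Bool) →
  countF p ≡ countF (p ∘ (_↑ˡ r)) + countF (p ∘ (m ↑ʳ_))
countF-↑ zero    p = refl
countF-↑ (suc m) p =
  trans (cong ((if p zero then 1 else 0) +_) (countF-↑ m (p ∘ suc)))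
        (sym (+-assoc (if p zero then 1 else 0) _ _))

remQuot-↑ʳ : ∀ {m} r (z : Fin (m * r)) →
  remQuot {suc m} r (r ↑ʳ z) ≡ (suc (quotient r z) , remainder {m} r z)
remQuot-↑ʳ {m} r z rewrite splitAt-↑ʳ r (m * r) z = refl

countF-× : ∀ m r (p : Fin m → Bool) (q : Fin r → Bool) →
  countF {m * r} (λ z → p (quotient r z) ∧ q (remainder {m} r z)) ≡ countF p * countF q
countF-× zero    r p q = refl
countF-× (suc m) r p q = begin
  countF h
    ≡⟨ countF-↑ r h ⟩
  countF (h ∘ (_↑ˡ m * r)) + countF (h ∘ (r ↑ʳ_))
    ≡⟨ cong₂ _+_ (countF-cong h-↑ˡ) (countF-cong h-↑ʳ) ⟩
  countF (λ j → p zero ∧ q j) + countF {m * r} (λ z → p (suc (quotient r z)) ∧ q (remainder {m} r z))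
    ≡⟨ cong₂ _+_ (countF-∧ˡ (p zero) q) (countF-× m r (p ∘ suc) q) ⟩
  (if p zero then 1 else 0) * countF q + countF (p ∘ suc) * countF q
    ≡⟨ *-distribʳ-+ (countF q) (if p zero then 1 else 0) (countF (p ∘ suc)) ⟨
  countF p * countF q
    ∎
  where
  h : Fin (suc m * r) → Bool
  h z = p (quotient r z) ∧ q (remainder {suc m} r z)
  h-↑ˡ : ∀ j → h (j ↑ˡ m * r) ≡ p zero ∧ q j
  h-↑ˡ j = cong (λ (u , i) → p u ∧ q i) (remQuot-combine {suc m} zero j)
  h-↑ʳ : ∀ z → h (r ↑ʳ z) ≡ p (suc (quotient r z)) ∧ q (remainder {m} r z)
  h-↑ʳ z = cong (λ (u , i) → p u ∧ q i) (remQuot-↑ʳ r z)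

module _ (G : Graph) where

  CommonNbhd⊆ : Fin (n G) → Fin (n G) → Fin (n G) → Set
  CommonNbhd⊆ a b c = (λ z → adj G a z ∧ adj G b z) ⊆ᵇ adj G c

  -- Membership in Y(a), expressed through G = Γ × Σ alone (k = val Γ, l = val Σ).
  InYᴳ : ℕ → ℕ → Fin (n G) → Fin (n G) → Set
  InYᴳ k l a b = (b ≢ a × IntRatio G l a b) × (∀ c → CommonNbhd⊆ a b c → k ∣ common G a c)

  PreservedByAut : (Fin (n G) → Fin (n G) → Set) → Set
  PreservedByAut R = ∀ τ → IsAut G τ → ∀ {a b} → R a b → R (τ ⟨$⟩ʳ a) (τ ⟨$⟩ʳ b)

  common-self : ∀ x → common G x x ≡ deg G x
  common-self x = countF-cong (λ z → ∧-idem (adj G x z))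

  common≤deg : ∀ x y → common G x y ≤ deg G x
  common≤deg x y = countF-mono (λ z → ∧-conicalˡ (adj G x z) (adj G y z))

  nbhd⊆⇒common≡deg : ∀ {x y} → adj G x ⊆ᵇ adj G y → common G x y ≡ deg G x
  nbhd⊆⇒common≡deg {x} {y} x⊆y = countF-cong absorb
    where
    absorb : ∀ z → adj G x z ∧ adj G y z ≡ adj G x z
    absorb z with adj G x z in xz
    ... | true  = x⊆y z xz
    ... | false = refl

  regular-thin-≡ : ∀ {k} → Regular G k → RThin G → ∀ {x y} → k ≤ common G x y → x ≡ y
  regular-thin-≡ reg thin {x} {y} k≤common =
    thin x y (λ z → ⇔→≡ (mk⇔ (x⊆y z) (y⊆x z)))
    where
    x⊆y : adj G x ⊆ᵇ adj G y
    x⊆y z xz = ∧-conicalʳ (adj G x z) (adj G y z)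
      (⊆ᵇ-countF-≤⇒⊇ (λ w → ∧-conicalˡ (adj G x w) (adj G y w))
        (subst (_≤ common G x y) (sym (reg x)) k≤common) z xz)
    y⊆x : adj G y ⊆ᵇ adj G x
    y⊆x z yz = ∧-conicalˡ (adj G x z) (adj G y z)
      (⊆ᵇ-countF-≤⇒⊇ (λ w → ∧-conicalʳ (adj G x w) (adj G y w))
        (subst (_≤ common G x y) (sym (reg y)) k≤common) z yz)

  IntRatio⇒common-nonZero : ∀ {l a b} .{{_ : NonZero (deg G a)}} →
    IntRatio G l a b → NonZero (common G a b)
  IntRatio⇒common-nonZero {l} {a} (r , 1≤r , eq) =
    m*n≢0⇒n≢0 l {{subst NonZero (sym eq) (m*n≢0 r (deg G a) {{>-nonZero 1≤r}})}}

  deg≡0⇒fGeq : ∀ {a} → deg G a ≡ 0 → ∀ b c → fGeq G a b c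
  deg≡0⇒fGeq {a} deg≡0 b c rewrite deg≡0 | *-zeroʳ (common G a c) = z≤n

  deg≡0⇒∣common : ∀ {a} → deg G a ≡ 0 → ∀ k c → k ∣ common G a c
  deg≡0⇒∣common {a} deg≡0 k c =
    subst (k ∣_) (sym (n≤0⇒n≡0 (subst (common G a c ≤_) deg≡0 (common≤deg a c)))) (k ∣0)

  module _ (τ : Permutation′ (n G)) (τ-aut : IsAut G τ) where

    deg-aut : ∀ a → deg G (τ ⟨$⟩ʳ a) ≡ deg G a
    deg-aut a = trans (sym (countF-permute (adj G (τ ⟨$⟩ʳ a)) τ)) (countF-cong (τ-aut a))

    common-aut : ∀ a b → common G (τ ⟨$⟩ʳ a) (τ ⟨$⟩ʳ b) ≡ common G a b
    common-aut a b =
      trans (sym (countF-permute (λ z → adj G (τ ⟨$⟩ʳ a) z ∧ adj G (τ ⟨$⟩ʳ b) z) τ))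
            (countF-cong (λ z → cong₂ _∧_ (τ-aut a z) (τ-aut b z)))

    CommonNbhd⊆-aut⁻¹ : ∀ {a b c} → CommonNbhd⊆ (τ ⟨$⟩ʳ a) (τ ⟨$⟩ʳ b) c →
      CommonNbhd⊆ a b (τ ⟨$⟩ˡ c)
    CommonNbhd⊆-aut⁻¹ {a} {b} {c} dom z abz = begin
      adj G (τ ⟨$⟩ˡ c) z
        ≡⟨ τ-aut (τ ⟨$⟩ˡ c) z ⟨
      adj G (τ ⟨$⟩ʳ (τ ⟨$⟩ˡ c)) (τ ⟨$⟩ʳ z)
        ≡⟨ cong (λ c′ → adj G c′ (τ ⟨$⟩ʳ z)) (inverseʳ τ) ⟩
      adj G c (τ ⟨$⟩ʳ z)
        ≡⟨ dom (τ ⟨$⟩ʳ z) (trans (cong₂ _∧_ (τ-aut a z) (τ-aut b z)) abz) ⟩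
      true
        ∎

  IsAut-flip : ∀ τ → IsAut G τ → IsAut G (flip τ)
  IsAut-flip τ τ-aut x y =
    trans (sym (τ-aut (τ ⟨$⟩ˡ x) (τ ⟨$⟩ˡ y))) (cong₂ (adj G) (inverseʳ τ) (inverseʳ τ))

  InYᴳ-preserved : ∀ k l → PreservedByAut (InYᴳ k l)
  InYᴳ-preserved k l τ τ-aut {a} {b} ((b≢a , r , 1≤r , eq) , divisible) =
    (b≢a ∘ permuted≡ , r , 1≤r , eq′) , divisible′
    where
    permuted≡ : τ ⟨$⟩ʳ b ≡ τ ⟨$⟩ʳ a → b ≡ a
    permuted≡ e = trans (sym (inverseˡ τ)) (trans (cong (τ ⟨$⟩ˡ_) e) (inverseˡ τ))
    eq′ : l * common G (τ ⟨$⟩ʳ a) (τ ⟨$⟩ʳ b) ≡ r * deg G (τ ⟨$⟩ʳ a)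
    eq′ rewrite common-aut τ τ-aut a b | deg-aut τ τ-aut a = eq
    divisible′ : ∀ c → CommonNbhd⊆ (τ ⟨$⟩ʳ a) (τ ⟨$⟩ʳ b) c → k ∣ common G (τ ⟨$⟩ʳ a) c
    divisible′ c dom = subst (λ c′ → k ∣ common G (τ ⟨$⟩ʳ a) c′) (inverseʳ τ)
      (subst (k ∣_) (sym (common-aut τ τ-aut a (τ ⟨$⟩ˡ c)))
        (divisible (τ ⟨$⟩ˡ c) (CommonNbhd⊆-aut⁻¹ τ τ-aut dom)))

  preservedByAut⇒image : ∀ {R} → PreservedByAut R → (σ : Aut G) (a : Fin (n G)) →
    (∀ b → R a b → R (proj₁ σ ⟨$⟩ʳ a) (proj₁ σ ⟨$⟩ʳ b))
    × (∀ c → R (proj₁ σ ⟨$⟩ʳ a) c → ∃ λ b → R a b × proj₁ σ ⟨$⟩ʳ b ≡ c)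
  preservedByAut⇒image {R} preserved (σ , σ-aut) a =
    (λ b → preserved σ σ-aut) ,
    (λ c r → σ ⟨$⟩ˡ c
           , subst (λ a′ → R a′ (σ ⟨$⟩ˡ c)) (inverseˡ σ)
               (preserved (flip σ) (IsAut-flip σ σ-aut) r)
           , inverseʳ σ)

module Product (Γ S : Graph) where

  P : Graph
  P = Γ ⊗ S

  vx-fstV-sndV : ∀ a → vx Γ S (fstV Γ S a) (sndV Γ S a) ≡ a
  vx-fstV-sndV = combine-remQuot {n Γ} (n S)

  vx-elim : {Q : Fin (n P) → Set} → (∀ u i → Q (vx Γ S u i)) → ∀ a → Q a
  vx-elim {Q} q a = subst Q (vx-fstV-sndV a) (q (fstV Γ S a) (sndV Γ S a))

  adj-vx : ∀ u i z → adj P (vx Γ S u i) z ≡ adj Γ u (fstV Γ S z) ∧ adj S i (sndV Γ S z)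
  adj-vx u i z = cong (λ (u′ , i′) → adj Γ u′ (fstV Γ S z) ∧ adj S i′ (sndV Γ S z))
                      (remQuot-combine u i)

  adj-vx-vx : ∀ u i v j → adj P (vx Γ S u i) (vx Γ S v j) ≡ adj Γ u v ∧ adj S i j
  adj-vx-vx u i v j = cong₂ (λ (u′ , i′) (v′ , j′) → adj Γ u′ v′ ∧ adj S i′ j′)
                            (remQuot-combine u i) (remQuot-combine v j)

  common-nbr-vx : ∀ u i v j z →
    adj P (vx Γ S u i) z ∧ adj P (vx Γ S v j) z
      ≡ (adj Γ u (fstV Γ S z) ∧ adj Γ v (fstV Γ S z)) ∧ (adj S i (sndV Γ S z) ∧ adj S j (sndV Γ S z))
  common-nbr-vx u i v j z = trans (cong₂ _∧_ (adj-vx u i z) (adj-vx v j z))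
    (interchange (adj Γ u (fstV Γ S z)) (adj S i (sndV Γ S z)) (adj Γ v (fstV Γ S z)) (adj S j (sndV Γ S z)))
    where
    open CommutativeSemigroupProperties
      (CommutativeMonoid.commutativeSemigroup ∧-commutativeMonoid) using (interchange)

  common-vx : ∀ u i v j → common P (vx Γ S u i) (vx Γ S v j) ≡ common Γ u v * common S i j
  common-vx u i v j = trans (countF-cong (common-nbr-vx u i v j))
    (countF-× (n Γ) (n S) (λ y → adj Γ u y ∧ adj Γ v y) (λ t → adj S i t ∧ adj S j t))

  IntRatio⇒factors-nonZero : ∀ l u i v j .{{_ : NonZero (deg P (vx Γ S u i))}} →
    IntRatio P l (vx Γ S u i) (vx Γ S v j) → NonZero (common Γ u v) × NonZero (common S i j)
  IntRatio⇒factors-nonZero l u i v j ratio =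
    m*n≢0⇒m≢0 (common Γ u v) {{product}} , m*n≢0⇒n≢0 (common Γ u v) {{product}}
    where
    product : NonZero (common Γ u v * common S i j)
    product = subst NonZero (common-vx u i v j) (IntRatio⇒common-nonZero P {l} ratio)

  same-fibre⇒maximal : ∀ {u i v j} → u ≡ v → ∀ w → fGeq P (vx Γ S u i) (vx Γ S v j) (vx Γ S w j)
  same-fibre⇒maximal {u} {i} {_} {j} refl w = *-monoˡ-≤ (deg P (vx Γ S u i))
    (subst₂ _≤_ (sym (common-vx u i w j)) (sym (common-vx u i u j))
      (*-monoˡ-≤ (common S i j) (subst (common Γ u w ≤_) (sym (common-self Γ u)) (common≤deg Γ u w))))

module Characterisation (Γ S : Graph) {k l : ℕ} (regΓ : Regular Γ k) (regS : Regular S l)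
                        (coprime : Coprime k l) (thinΓ : RThin Γ) where
  open Product Γ S

  same-fibre⇒divisible : ∀ {u i v j} → u ≡ v → .{{_ : NonZero (common S i j)}} →
    ∀ c → CommonNbhd⊆ P (vx Γ S u i) (vx Γ S v j) c → k ∣ common P (vx Γ S u i) c
  same-fibre⇒divisible {u} {i} {_} {j} refl = vx-elim divisible
    where
    shared : ∃ λ t → adj S i t ∧ adj S j t ≡ true
    shared = countF-nonZero⇒∃ (λ t → adj S i t ∧ adj S j t)
    t = proj₁ shared
    divisible : ∀ w m → CommonNbhd⊆ P (vx Γ S u i) (vx Γ S u j) (vx Γ S w m) →
                k ∣ common P (vx Γ S u i) (vx Γ S w m)
    divisible w m dom = subst (k ∣_) (sym (common-vx u i w m))
      (subst (λ x → k ∣ x * common S i m) (sym (trans (nbhd⊆⇒common≡deg Γ u⊆w) (regΓ u))) (m∣m*n _))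
      where
      u⊆w : adj Γ u ⊆ᵇ adj Γ w
      u⊆w y uy = ∧-conicalˡ (adj Γ w y) (adj S m t)
        (trans (sym (adj-vx-vx w m y t)) (dom (vx Γ S y t) common-nbr))
        where
        common-nbr : adj P (vx Γ S u i) (vx Γ S y t) ∧ adj P (vx Γ S u j) (vx Γ S y t) ≡ true
        common-nbr = begin
          adj P (vx Γ S u i) (vx Γ S y t) ∧ adj P (vx Γ S u j) (vx Γ S y t)
            ≡⟨ cong₂ _∧_ (adj-vx-vx u i y t) (adj-vx-vx u j y t) ⟩
          (adj Γ u y ∧ adj S i t) ∧ (adj Γ u y ∧ adj S j t)
            ≡⟨ cong (λ b → (b ∧ adj S i t) ∧ (b ∧ adj S j t)) uy ⟩
          adj S i t ∧ adj S j t
            ≡⟨ proj₂ shared ⟩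
          true ∎

  Y⇒same-fibre : ∀ {u i v j} .{{_ : NonZero (deg P (vx Γ S u i))}} → InY Γ S l u i v j → u ≡ v
  Y⇒same-fibre {u} {i} {v} {j} ((_ , ratio) , maximal) = regular-thin-≡ Γ regΓ thinΓ
    (subst (_≤ common Γ u v) (trans (common-self Γ u) (regΓ u))
      (*-cancelʳ-≤ _ _ (common S i j) {{proj₂ (IntRatio⇒factors-nonZero l u i v j ratio)}}
        (subst₂ _≤_ (common-vx u i u j) (common-vx u i v j)
          (*-cancelʳ-≤ _ _ (deg P (vx Γ S u i)) (maximal u)))))

  Yᴳ⇒same-fibre : ∀ {u i v j} .{{_ : NonZero (deg P (vx Γ S u i))}} →
    InYᴳ P k l (vx Γ S u i) (vx Γ S v j) → u ≡ v
  Yᴳ⇒same-fibre {u} {i} {v} {j} ((_ , ratio) , divisible) =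
    regular-thin-≡ Γ regΓ thinΓ (∣⇒≤ {{proj₁ (IntRatio⇒factors-nonZero l u i v j ratio)}} k∣common)
    where
    dom : CommonNbhd⊆ P (vx Γ S u i) (vx Γ S v j) (vx Γ S v i)
    dom z uivj = trans (adj-vx v i z) (cong₂ _∧_ (∧-conicalʳ uy vy Γ-part) (∧-conicalˡ it jt S-part))
      where
      uy = adj Γ u (fstV Γ S z)
      vy = adj Γ v (fstV Γ S z)
      it = adj S i (sndV Γ S z)
      jt = adj S j (sndV Γ S z)
      split = trans (sym (common-nbr-vx u i v j z)) uivj
      Γ-part = ∧-conicalˡ (uy ∧ vy) (it ∧ jt) split
      S-part = ∧-conicalʳ (uy ∧ vy) (it ∧ jt) split
    k∣common : k ∣ common Γ u v
    k∣common = coprime-divisor coprime (subst (k ∣_) (begin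
      common P (vx Γ S u i) (vx Γ S v i)  ≡⟨ common-vx u i v i ⟩
      common Γ u v * common S i i        ≡⟨ cong (common Γ u v *_) (trans (common-self S i) (regS i)) ⟩
      common Γ u v * l                   ≡⟨ *-comm (common Γ u v) l ⟩
      l * common Γ u v                   ∎) (divisible (vx Γ S v i) dom))

  InY⇔InYᴳ : ∀ u i v j → InY Γ S l u i v j ⇔ InYᴳ P k l (vx Γ S u i) (vx Γ S v j)
  InY⇔InYᴳ u i v j with deg P (vx Γ S u i) ≟ 0
  ... | yes deg≡0 = mk⇔ (λ (x , _) → x , λ c _ → deg≡0⇒∣common P deg≡0 k c)
                        (λ (x , _) → x , λ w → deg≡0⇒fGeq P deg≡0 _ _)
  ... | no deg≢0 = mk⇔
    (λ y@((_ , ratio) , _) → proj₁ y ,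
      same-fibre⇒divisible (Y⇒same-fibre y) {{proj₂ (IntRatio⇒factors-nonZero l u i v j ratio)}})
    (λ y → proj₁ y , same-fibre⇒maximal (Yᴳ⇒same-fibre y))
    where instance _ = ≢-nonZero deg≢0

  InY'⇔InYᴳ : ∀ a b → InY' Γ S l a b ⇔ InYᴳ P k l a b
  InY'⇔InYᴳ a b = subst₂ (λ a′ b′ → InY' Γ S l a b ⇔ InYᴳ P k l a′ b′)
    (vx-fstV-sndV a) (vx-fstV-sndV b) (InY⇔InYᴳ _ _ _ _)

  InY'-preserved : PreservedByAut P (InY' Γ S l)
  InY'-preserved τ τ-aut {a} {b} y = Equivalence.from (InY'⇔InYᴳ (τ ⟨$⟩ʳ a) (τ ⟨$⟩ʳ b))
    (InYᴳ-preserved P k l τ τ-aut (Equivalence.to (InY'⇔InYᴳ a b) y))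

-- Only Γ needs to be R-thin.
lemma4p9 : (Γ S : Graph) (k l : ℕ) →
    Regular Γ k → Regular S l → Coprime k l → 2 ≤ n S →
    RThin Γ → RThin S → VertexTransitive S →
    (u : Fin (n Γ)) (i : Fin (n S)) (σ : Aut (Γ ⊗ S)) →
    (∀ b → InY' Γ S l (vx Γ S u i) b →
       InY' Γ S l (proj₁ σ ⟨$⟩ʳ vx Γ S u i) (proj₁ σ ⟨$⟩ʳ b))
    × (∀ c → InY' Γ S l (proj₁ σ ⟨$⟩ʳ vx Γ S u i) c →
       ∃ λ b → InY' Γ S l (vx Γ S u i) b × proj₁ σ ⟨$⟩ʳ b ≡ c)
lemma4p9 Γ S k l regΓ regS coprime _ thinΓ _ _ u i σ =
  preservedByAut⇒image (Γ ⊗ S)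
    (Characterisation.InY'-preserved Γ S regΓ regS coprime thinΓ) σ (vx Γ S u i)
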